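{- Let $\varepsilon>0$ be rational, let $F$ be a closed formula of formal arithmetic, and let $\pi$ be a proof strategy with initial capital $\varepsilon$. If the probability that $\pi$ achieves $F$ is greater than $\varepsilon$, then $F$ is provable in formal arithmetic, without any additional axioms.
   Context: Formal arithmetic means Peano arithmetic (PA); binary strings and numbers are coded in arithmetic in the usual way. A proof strategy with initial capital $\varepsilon$ is a finite tree describing a randomized proof process. The process maintains a set of accepted closed statements, initially empty, and a remaining capital, initially $\varepsilon$. At each node the strategy takes one of two kinds of steps. (i) An ordinary step: it accepts a formula that follows by the usual logical rules from the axioms of PA and the statements accepted so far. (ii) A randomized step: it must already have accepted, for some numeral $N$, some rational $\delta>0$ not exceeding the remaining capital, and some arithmetic formula $R(x)$ with one free string variable $x$, the closed statement "the number of strings $x$ of length $N$ such that $\lnot R(x)$ is at most $\delta 2^N$". It then tosses a fair coin $N$ times to obtain a uniformly random string $r$ of length $N$, accepts $R(r)$ as a new axiom, and the remaining capital decreases by $\delta$. The node branches into $2^N$ children, one for each outcome $r$, and the strategy specifies the subsequent steps separately for every outcome. The strategy achieves $F$ on a branch if $F$ is among the accepted statements on that branch. The probability of achieving $F$ is taken over the coin tosses. -}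

module Defs where

open import Data.Nat as ℕ using (ℕ; zero; suc; _^_)
open import Data.Nat.DivMod using (_/_)
open import Data.Fin as Fin using (Fin; zero; suc)
import Data.Fin.Properties as FinP
open import Data.Bool using (Bool; true; false)
open import Data.Vec using (Vec; []; _∷_)
open import Data.List using (List; []; _∷_; map)
open import Data.List.Membership.Propositional using (_∈_)
import Data.List.Membership.DecPropositional as DecMem
open import Data.Integer using (∣_∣)
open import Data.Rational as ℚ using (ℚ; 0ℚ; 1ℚ; ½; _-_; _+_; _*_; _<_; _≤_; ↥_)
open import Relation.Binary.PropositionalEquality using (_≡_; refl; cong; cong₂)
open import Relation.Nullary using (Dec; yes; no)
open import Relation.Nullary.Decidable using (does)

-- Syntax of first-order arithmetic (language 0, S, +, ×, =),
-- well-scoped de Bruijn: Term n / Formula n have n free variables.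

data Term (n : ℕ) : Set where
  var  : Fin n → Term n
  zer  : Term n
  succ : Term n → Term n
  _⊕_  : Term n → Term n → Term n
  _⊗_  : Term n → Term n → Term n

infix  6 _≐_
infixr 5 _⇒_

data Formula (n : ℕ) : Set where
  _≐_ : Term n → Term n → Formula n
  ⊥'  : Formula n
  _⇒_ : Formula n → Formula n → Formula n
  ∀'  : Formula (suc n) → Formula n

Sentence : Set
Sentence = Formula 0

¬' : ∀ {n} → Formula n → Formula n
¬' φ = φ ⇒ ⊥'

⊤' : ∀ {n} → Formula n
⊤' = ¬' ⊥'

_∧'_ : ∀ {n} → Formula n → Formula n → Formula n
φ ∧' ψ = ¬' (φ ⇒ ¬' ψ)

∃' : ∀ {n} → Formula (suc n) → Formula n
∃' φ = ¬' (∀' (¬' φ))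

liftR : ∀ {n m} → (Fin n → Fin m) → Fin (suc n) → Fin (suc m)
liftR ρ zero    = zero
liftR ρ (suc i) = suc (ρ i)

renT : ∀ {n m} → (Fin n → Fin m) → Term n → Term m
renT ρ (var i)  = var (ρ i)
renT ρ zer      = zer
renT ρ (succ t) = succ (renT ρ t)
renT ρ (s ⊕ t)  = renT ρ s ⊕ renT ρ t
renT ρ (s ⊗ t)  = renT ρ s ⊗ renT ρ t

ren : ∀ {n m} → (Fin n → Fin m) → Formula n → Formula m
ren ρ (s ≐ t) = renT ρ s ≐ renT ρ t
ren ρ ⊥'      = ⊥'
ren ρ (φ ⇒ ψ) = ren ρ φ ⇒ ren ρ ψ
ren ρ (∀' φ)  = ∀' (ren (liftR ρ) φ)

liftS : ∀ {n m} → (Fin n → Term m) → Fin (suc n) → Term (suc m)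
liftS σ zero    = var zero
liftS σ (suc i) = renT suc (σ i)

subT : ∀ {n m} → (Fin n → Term m) → Term n → Term m
subT σ (var i)  = σ i
subT σ zer      = zer
subT σ (succ t) = succ (subT σ t)
subT σ (s ⊕ t)  = subT σ s ⊕ subT σ t
subT σ (s ⊗ t)  = subT σ s ⊗ subT σ t

sub : ∀ {n m} → (Fin n → Term m) → Formula n → Formula m
sub σ (s ≐ t) = subT σ s ≐ subT σ t
sub σ ⊥'      = ⊥'
sub σ (φ ⇒ ψ) = sub σ φ ⇒ sub σ ψ
sub σ (∀' φ)  = ∀' (sub (liftS σ) φ)

subst₀ : ∀ {n} → Term n → Fin (suc n) → Term n
subst₀ t zero    = t
subst₀ t (suc i) = var i

_[_] : ∀ {n} → Formula (suc n) → Term n → Formula n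
φ [ t ] = sub (subst₀ t) φ

x₀ x₁ : ∀ {n} → Term (suc (suc n))
x₀ = var zero
x₁ = var (suc zero)

stepSub : ∀ {n} → Fin (suc n) → Term (suc n)
stepSub zero    = succ (var zero)
stepSub (suc i) = var (suc i)

data PAxiom {n : ℕ} : Formula n → Set where
  pa-succ-ne-zero : PAxiom (∀' (¬' (succ (var zero) ≐ zer)))
  pa-succ-inj     : PAxiom (∀' (∀' (succ x₁ ≐ succ x₀ ⇒ x₁ ≐ x₀)))
  pa-plus-zero    : PAxiom (∀' (var zero ⊕ zer ≐ var zero))
  pa-plus-succ    : PAxiom (∀' (∀' (x₁ ⊕ succ x₀ ≐ succ (x₁ ⊕ x₀))))
  pa-times-zero   : PAxiom (∀' (var zero ⊗ zer ≐ zer))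
  pa-times-succ   : PAxiom (∀' (∀' (x₁ ⊗ succ x₀ ≐ (x₁ ⊗ x₀) ⊕ x₁)))
  pa-induction    : (φ : Formula (suc n)) →
    PAxiom (φ [ zer ] ⇒ ∀' (φ ⇒ sub stepSub φ) ⇒ ∀' φ)

infix 3 _⊢_

data _⊢_ : {n : ℕ} → List (Formula n) → Formula n → Set where
  hyp    : ∀ {n} {Γ : List (Formula n)} {φ} → φ ∈ Γ → Γ ⊢ φ
  axiom  : ∀ {n} {Γ : List (Formula n)} {φ} → PAxiom φ → Γ ⊢ φ
  ⇒-intro : ∀ {n} {Γ : List (Formula n)} {φ ψ} → (φ ∷ Γ) ⊢ ψ → Γ ⊢ φ ⇒ ψ
  ⇒-elim  : ∀ {n} {Γ : List (Formula n)} {φ ψ} → Γ ⊢ φ ⇒ ψ → Γ ⊢ φ → Γ ⊢ ψ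
  raa     : ∀ {n} {Γ : List (Formula n)} {φ} → (¬' φ ∷ Γ) ⊢ ⊥' → Γ ⊢ φ
  ∀-intro : ∀ {n} {Γ : List (Formula n)} {φ} → map (ren suc) Γ ⊢ φ → Γ ⊢ ∀' φ
  ∀-elim  : ∀ {n} {Γ : List (Formula n)} {φ} → Γ ⊢ ∀' φ → (t : Term n) → Γ ⊢ φ [ t ]
  ≐-refl  : ∀ {n} {Γ : List (Formula n)} (t : Term n) → Γ ⊢ t ≐ t
  ≐-subst : ∀ {n} {Γ : List (Formula n)} (φ : Formula (suc n)) {s t : Term n} →
            Γ ⊢ s ≐ t → Γ ⊢ φ [ s ] → Γ ⊢ φ [ t ]

PA⊢ : Sentence → Set
PA⊢ F = [] ⊢ F

-- A string r = b₁…b_N of length N is coded by the number whose binary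
-- expansion is 1b₁…b_N, i.e. 2^N + (value of b₁…b_N); the strings of
-- length N are exactly the codes x with 2^N ≤ x < 2^(N+1).

numeral : ∀ {n} → ℕ → Term n
numeral zero    = zer
numeral (suc k) = succ (numeral k)

bitsValue : ∀ {N} → ℕ → Vec Bool N → ℕ
bitsValue acc []           = acc
bitsValue acc (false ∷ bs) = bitsValue (acc ℕ.* 2) bs
bitsValue acc (true  ∷ bs) = bitsValue (suc (acc ℕ.* 2)) bs

code : ∀ {N} → Vec Bool N → ℕ
code bs = bitsValue 1 bs

_≤'_ : ∀ {n} → Term n → Term n → Formula n
a ≤' b = ∃' (renT suc a ⊕ var zero ≐ renT suc b)

_<'_ : ∀ {n} → Term n → Term n → Formula n
a <' b = succ a ≤' b

IsStr : ∀ {n} → ℕ → Term n → Formula n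
IsStr N t = (numeral (2 ^ N) ≤' t) ∧' (t <' numeral (2 ^ suc N))

keep0 : Fin 1 → Fin 2
keep0 zero = zero

Bad : ℕ → Formula 1 → Formula 1
Bad N R = IsStr N (var zero) ∧' ¬' R

-- MoreAbove N R k (x₀) := there are x₀ < y₁ < … < y_k all Bad
MoreAbove : ℕ → Formula 1 → ℕ → Formula 1
MoreAbove N R zero    = ⊤'
MoreAbove N R (suc k) =
  ∃' ((var (suc zero) <' var zero) ∧' (ren keep0 (Bad N R) ∧' ren keep0 (MoreAbove N R k)))

AtLeastSuc : ℕ → Formula 1 → ℕ → Sentence
AtLeastSuc N R k = ∃' (Bad N R ∧' MoreAbove N R k)

floorScaled : ℚ → ℕ → ℕ
floorScaled δ N = (∣ ↥ δ ∣ ℕ.* 2 ^ N) / suc (ℚ.denominator-1 δ)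

-- "the number of strings x of length N with ¬R(x) is at most δ·2^N"
-- (equivalently: at most ⌊δ 2^N⌋, i.e. not at least ⌊δ 2^N⌋+1)
CountBound : ℕ → ℚ → Formula 1 → Sentence
CountBound N δ R = ¬' (AtLeastSuc N R (floorScaled δ N))

-- Proof strategies.  Strategy Γ c : a finite tree, Γ = statements
-- accepted so far, c = remaining capital.

data Strategy (Γ : List Sentence) (c : ℚ) : Set where
  stop       : Strategy Γ c
  ordinary   : (φ : Sentence) → Γ ⊢ φ → Strategy (φ ∷ Γ) c → Strategy Γ c
  randomized : (N : ℕ) (δ : ℚ) (R : Formula 1) →
               0ℚ < δ → δ ≤ c → CountBound N δ R ∈ Γ →
               ((r : Vec Bool N) → Strategy (R [ numeral (code r) ] ∷ Γ) (c - δ)) →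
               Strategy Γ c

-- Decidable equality of formulas (needed to test F ∈ accepted)

suc-injT : ∀ {n} {s t : Term n} → succ s ≡ succ t → s ≡ t
suc-injT refl = refl

_≟T_ : ∀ {n} (s t : Term n) → Dec (s ≡ t)
var i ≟T var j with i FinP.≟ j
... | yes refl = yes refl
... | no ne = no λ { refl → ne refl }
var i ≟T zer = no λ ()
var i ≟T succ t = no λ ()
var i ≟T (t ⊕ t₁) = no λ ()
var i ≟T (t ⊗ t₁) = no λ ()
zer ≟T var j = no λ ()
zer ≟T zer = yes refl
zer ≟T succ t = no λ ()
zer ≟T (t ⊕ t₁) = no λ ()
zer ≟T (t ⊗ t₁) = no λ ()
succ s ≟T var j = no λ ()
succ s ≟T zer = no λ ()
succ s ≟T succ t with s ≟T t
... | yes refl = yes refl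
... | no ne = no λ { refl → ne refl }
succ s ≟T (t ⊕ t₁) = no λ ()
succ s ≟T (t ⊗ t₁) = no λ ()
(s ⊕ s₁) ≟T var j = no λ ()
(s ⊕ s₁) ≟T zer = no λ ()
(s ⊕ s₁) ≟T succ t = no λ ()
(s ⊕ s₁) ≟T (t ⊕ t₁) with s ≟T t | s₁ ≟T t₁
... | yes refl | yes refl = yes refl
... | no ne | _ = no λ { refl → ne refl }
... | yes _ | no ne = no λ { refl → ne refl }
(s ⊕ s₁) ≟T (t ⊗ t₁) = no λ ()
(s ⊗ s₁) ≟T var j = no λ ()
(s ⊗ s₁) ≟T zer = no λ ()
(s ⊗ s₁) ≟T succ t = no λ ()
(s ⊗ s₁) ≟T (t ⊕ t₁) = no λ ()
(s ⊗ s₁) ≟T (t ⊗ t₁) with s ≟T t | s₁ ≟T t₁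
... | yes refl | yes refl = yes refl
... | no ne | _ = no λ { refl → ne refl }
... | yes _ | no ne = no λ { refl → ne refl }

_≟F_ : ∀ {n} (φ ψ : Formula n) → Dec (φ ≡ ψ)
(s ≐ t) ≟F (s' ≐ t') with s ≟T s' | t ≟T t'
... | yes refl | yes refl = yes refl
... | no ne | _ = no λ { refl → ne refl }
... | yes _ | no ne = no λ { refl → ne refl }
(s ≐ t) ≟F ⊥' = no λ ()
(s ≐ t) ≟F (_ ⇒ _) = no λ ()
(s ≐ t) ≟F ∀' _ = no λ ()
⊥' ≟F (_ ≐ _) = no λ ()
⊥' ≟F ⊥' = yes refl
⊥' ≟F (_ ⇒ _) = no λ ()
⊥' ≟F ∀' _ = no λ ()
(φ ⇒ ψ) ≟F (_ ≐ _) = no λ ()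
(φ ⇒ ψ) ≟F ⊥' = no λ ()
(φ ⇒ ψ) ≟F (φ' ⇒ ψ') with φ ≟F φ' | ψ ≟F ψ'
... | yes refl | yes refl = yes refl
... | no ne | _ = no λ { refl → ne refl }
... | yes _ | no ne = no λ { refl → ne refl }
(φ ⇒ ψ) ≟F ∀' _ = no λ ()
∀' φ ≟F (_ ≐ _) = no λ ()
∀' φ ≟F ⊥' = no λ ()
∀' φ ≟F (_ ⇒ _) = no λ ()
∀' φ ≟F ∀' ψ with φ ≟F ψ
... | yes refl = yes refl
... | no ne = no λ { refl → ne refl }

-- Probability of achieving F (F accepted at the end of the branch;
-- accepted sets only grow along a branch), over uniform fair coins.

avg : (N : ℕ) → (Vec Bool N → ℚ) → ℚ
avg zero    f = f []
avg (suc N) f = ½ * (avg N (λ r → f (true ∷ r)) + avg N (λ r → f (false ∷ r)))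

ProbAchieve : ∀ {Γ c} → Sentence → Strategy Γ c → ℚ
ProbAchieve {Γ} F stop with DecMem._∈?_ _≟F_ F Γ
... | yes _ = 1ℚ
... | no  _ = 0ℚ
ProbAchieve F (ordinary φ d π) = ProbAchieve F π
ProbAchieve F (randomized N δ R _ _ _ k) = avg N (λ r → ProbAchieve F (k r))

-- The proof is by induction on the strategy, with the invariant
-- "capital c ≥ 0 and Prob(achieve F) > c  ⇒  accepted statements ⊢ F".
-- At a leaf the probability is 0 or 1, so it must be 1 and F is accepted.
-- At a randomized step with count-bound axiom for R, threshold δ and N coins,
-- let d = c - δ ≥ 0 be the capital of the children and call an outcome r
-- good when its child achieves F with probability > d.  A Markov-type
-- averaging argument (probabilities are ≤ 1) shows that more than δ·2^N
-- outcomes are good.  By induction each good r gives Γ, R(r) ⊢ F, hence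
-- Γ, ¬F ⊢ ¬R(r); listing the good strings in increasing order of their
-- codes, these refutations assemble into a proof of "at least ⌊δ 2^N⌋+1
-- strings x satisfy ¬R(x)" from Γ, ¬F, contradicting the accepted count
-- bound.  So Γ ⊢ F by reductio.

module Submission where

open import Defs
open import Data.Nat as ℕ using (ℕ; zero; suc; _^_; s≤s)
import Data.Nat.Properties as ℕP
import Data.Nat.DivMod as ℕDivMod
open import Data.Integer as ℤ using (+_; -[1+_])
import Data.Integer.Properties as ℤP
open import Data.Rational as ℚ using (ℚ; mkℚ; 0ℚ; 1ℚ; ½; _+_; _*_; _-_; -_; _<_; _≤_; ↥_)
open import Data.Rational.Literals using (fromℤ)
import Data.Rational.Properties as ℚP
import Data.Rational.Unnormalised as ℚᵘ
import Data.Rational.Unnormalised.Properties as ℚᵘP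
open import Data.Rational.Solver using (module +-*-Solver)
open import Data.Fin using (Fin; zero; suc)
open import Data.Bool using (Bool; true; false; if_then_else_)
open import Data.Vec using (Vec; []; _∷_)
open import Data.List using (List; []; _∷_; map; _++_; length; filter)
import Data.List.Properties as ListP
open import Data.List.Membership.Propositional using (_∈_)
open import Data.List.Membership.Propositional.Properties using (∈-map⁺; ∈-map⁻)
import Data.List.Membership.DecPropositional as DecMembership
open import Data.List.Relation.Unary.Any using (here; there)
open import Data.List.Relation.Unary.All as All using (All; []; _∷_)
import Data.List.Relation.Unary.All.Properties as AllP
open import Data.List.Relation.Unary.AllPairs using (AllPairs; []; _∷_)
import Data.List.Relation.Unary.AllPairs.Properties as AllPairsP
open import Data.Product using (_,_)
open import Data.Empty using (⊥-elim)
open import Relation.Nullary using (Dec; yes; no; does)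
open import Level using (0ℓ)
open import Relation.Unary using (Pred; Decidable)
open import Relation.Binary.PropositionalEquality
  using (_≡_; refl; cong; cong₂; sym; trans; subst; subst₂; module ≡-Reasoning)

open +-*-Solver

subT-numeral : ∀ {n m} (σ : Fin n → Term m) k → subT σ (numeral k) ≡ numeral k
subT-numeral σ zero    = refl
subT-numeral σ (suc k) = cong succ (subT-numeral σ k)

subst₀-weaken : ∀ {n} (t s : Term n) → subT (subst₀ t) (renT suc s) ≡ s
subst₀-weaken t (var i)  = refl
subst₀-weaken t zer      = refl
subst₀-weaken t (succ s) = cong succ (subst₀-weaken t s)
subst₀-weaken t (s ⊕ u)  = cong₂ _⊕_ (subst₀-weaken t s) (subst₀-weaken t u)
subst₀-weaken t (s ⊗ u)  = cong₂ _⊗_ (subst₀-weaken t s) (subst₀-weaken t u)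

subT-cong : ∀ {n m} {σ τ : Fin n → Term m} → (∀ i → σ i ≡ τ i) → ∀ t → subT σ t ≡ subT τ t
subT-cong e (var i)  = e i
subT-cong e zer      = refl
subT-cong e (succ t) = cong succ (subT-cong e t)
subT-cong e (s ⊕ t)  = cong₂ _⊕_ (subT-cong e s) (subT-cong e t)
subT-cong e (s ⊗ t)  = cong₂ _⊗_ (subT-cong e s) (subT-cong e t)

sub-cong : ∀ {n m} {σ τ : Fin n → Term m} → (∀ i → σ i ≡ τ i) → ∀ φ → sub σ φ ≡ sub τ φ
sub-cong e (s ≐ t) = cong₂ _≐_ (subT-cong e s) (subT-cong e t)
sub-cong e ⊥'      = refl
sub-cong e (φ ⇒ ψ) = cong₂ _⇒_ (sub-cong e φ) (sub-cong e ψ)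
sub-cong e (∀' φ)  = cong ∀' (sub-cong lift-e φ)
  where
  lift-e : ∀ i → liftS _ i ≡ liftS _ i
  lift-e zero    = refl
  lift-e (suc i) = cong (renT suc) (e i)

subT-renT : ∀ {n m k} (σ : Fin m → Term k) (ρ : Fin n → Fin m) t →
            subT σ (renT ρ t) ≡ subT (λ i → σ (ρ i)) t
subT-renT σ ρ (var i)  = refl
subT-renT σ ρ zer      = refl
subT-renT σ ρ (succ t) = cong succ (subT-renT σ ρ t)
subT-renT σ ρ (s ⊕ t)  = cong₂ _⊕_ (subT-renT σ ρ s) (subT-renT σ ρ t)
subT-renT σ ρ (s ⊗ t)  = cong₂ _⊗_ (subT-renT σ ρ s) (subT-renT σ ρ t)

sub-ren : ∀ {n m k} (σ : Fin m → Term k) (ρ : Fin n → Fin m) φ →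
          sub σ (ren ρ φ) ≡ sub (λ i → σ (ρ i)) φ
sub-ren σ ρ (s ≐ t) = cong₂ _≐_ (subT-renT σ ρ s) (subT-renT σ ρ t)
sub-ren σ ρ ⊥'      = refl
sub-ren σ ρ (φ ⇒ ψ) = cong₂ _⇒_ (sub-ren σ ρ φ) (sub-ren σ ρ ψ)
sub-ren σ ρ (∀' φ)  = cong ∀' (trans (sub-ren (liftS σ) (liftR ρ) φ) (sub-cong lift-e φ))
  where
  lift-e : ∀ i → liftS σ (liftR ρ i) ≡ liftS (λ j → σ (ρ j)) i
  lift-e zero    = refl
  lift-e (suc i) = refl

liftS-weaken : ∀ {n m} (σ : Fin n → Term m) t → subT (liftS σ) (renT suc t) ≡ renT suc (subT σ t)
liftS-weaken σ (var i)  = refl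
liftS-weaken σ zer      = refl
liftS-weaken σ (succ t) = cong succ (liftS-weaken σ t)
liftS-weaken σ (s ⊕ t)  = cong₂ _⊕_ (liftS-weaken σ s) (liftS-weaken σ t)
liftS-weaken σ (s ⊗ t)  = cong₂ _⊗_ (liftS-weaken σ s) (liftS-weaken σ t)

subT-subT : ∀ {n m k} (τ : Fin m → Term k) (σ : Fin n → Term m) t →
            subT τ (subT σ t) ≡ subT (λ i → subT τ (σ i)) t
subT-subT τ σ (var i)  = refl
subT-subT τ σ zer      = refl
subT-subT τ σ (succ t) = cong succ (subT-subT τ σ t)
subT-subT τ σ (s ⊕ t)  = cong₂ _⊕_ (subT-subT τ σ s) (subT-subT τ σ t)
subT-subT τ σ (s ⊗ t)  = cong₂ _⊗_ (subT-subT τ σ s) (subT-subT τ σ t)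

sub-sub : ∀ {n m k} (τ : Fin m → Term k) (σ : Fin n → Term m) φ →
          sub τ (sub σ φ) ≡ sub (λ i → subT τ (σ i)) φ
sub-sub τ σ (s ≐ t) = cong₂ _≐_ (subT-subT τ σ s) (subT-subT τ σ t)
sub-sub τ σ ⊥'      = refl
sub-sub τ σ (φ ⇒ ψ) = cong₂ _⇒_ (sub-sub τ σ φ) (sub-sub τ σ ψ)
sub-sub τ σ (∀' φ)  = cong ∀' (trans (sub-sub (liftS τ) (liftS σ) φ) (sub-cong lift-e φ))
  where
  lift-e : ∀ i → subT (liftS τ) (liftS σ i) ≡ liftS (λ j → subT τ (σ j)) i
  lift-e zero    = refl
  lift-e (suc i) = liftS-weaken τ (σ i)

sub-≤' : ∀ {n m} (σ : Fin n → Term m) a b → sub σ (a ≤' b) ≡ (subT σ a ≤' subT σ b)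
sub-≤' σ a b = cong₂ (λ u v → ¬' (∀' (¬' (u ⊕ var zero ≐ v)))) (liftS-weaken σ a) (liftS-weaken σ b)

sub-<' : ∀ {n m} (σ : Fin n → Term m) a b → sub σ (a <' b) ≡ (subT σ a <' subT σ b)
sub-<' σ a b = sub-≤' σ (succ a) b

sub-IsStr : ∀ {n m} (σ : Fin n → Term m) N t → sub σ (IsStr N t) ≡ IsStr N (subT σ t)
sub-IsStr σ N t = cong₂ _∧'_
  (trans (sub-≤' σ (numeral (2 ^ N)) t) (cong (_≤' subT σ t) (subT-numeral σ (2 ^ N))))
  (trans (sub-<' σ t (numeral (2 ^ suc N))) (cong (subT σ t <'_) (subT-numeral σ (2 ^ suc N))))

Bad-instance : ∀ N R (t : Term 0) → Bad N R [ t ] ≡ (IsStr N t ∧' ¬' (R [ t ]))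
Bad-instance N R t = cong (λ u → u ∧' ¬' (R [ t ])) (sub-IsStr (subst₀ t) N (var zero))

-- Inside MoreAbove, a formula is moved under a new outermost bound
-- variable y by ren keep0; instantiating both x and y only keeps y.
keep0-instance : ∀ (x u : Term 0) (φ : Formula 1) →
  sub (subst₀ u) (sub (liftS (subst₀ x)) (ren keep0 φ)) ≡ φ [ u ]
keep0-instance x u φ =
  trans (sub-sub (subst₀ u) (liftS (subst₀ x)) (ren keep0 φ))
        (trans (sub-ren _ keep0 φ) (sub-cong (λ { zero → refl }) φ))

ordering-instance : ∀ (x u : Term 0) →
  sub (subst₀ u) (sub (liftS (subst₀ x)) (var (suc zero) <' var zero)) ≡ (x <' u)
ordering-instance x u =
  trans (cong (sub (subst₀ u)) (sub-<' (liftS (subst₀ x)) (var (suc zero)) (var zero)))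
        (trans (sub-<' (subst₀ u) (renT suc x) (var zero))
               (cong (_<' u) (subst₀-weaken u x)))

-- Derived rules of the calculus.

cast : ∀ {n} {Γ : List (Formula n)} {φ ψ} → φ ≡ ψ → Γ ⊢ φ → Γ ⊢ ψ
cast e d = subst (_ ⊢_) e d

weaken : ∀ {n} {Γ Δ : List (Formula n)} {φ} → (∀ {ψ} → ψ ∈ Γ → ψ ∈ Δ) → Γ ⊢ φ → Δ ⊢ φ
weaken s (hyp x)           = hyp (s x)
weaken s (axiom x)         = axiom x
weaken s (⇒-intro d)       = ⇒-intro (weaken (λ { (here p) → here p ; (there q) → there (s q) }) d)
weaken s (⇒-elim d e)      = ⇒-elim (weaken s d) (weaken s e)
weaken s (raa d)           = raa (weaken (λ { (here p) → here p ; (there q) → there (s q) }) d)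
weaken s (∀-intro d)       = ∀-intro (weaken shifted d)
  where
  shifted : ∀ {ψ} → ψ ∈ map (ren suc) _ → ψ ∈ map (ren suc) _
  shifted m with ∈-map⁻ (ren suc) m
  ... | _ , x∈ , refl = ∈-map⁺ (ren suc) (s x∈)
weaken s (∀-elim d t)      = ∀-elim (weaken s d) t
weaken s (≐-refl t)        = ≐-refl t
weaken s (≐-subst φ d e)   = ≐-subst φ (weaken s d) (weaken s e)

weaken₁ : ∀ {n} {Γ : List (Formula n)} {φ χ} → Γ ⊢ φ → (χ ∷ Γ) ⊢ φ
weaken₁ = weaken there

∃-intro : ∀ {n} {Γ : List (Formula n)} (φ : Formula (suc n)) (t : Term n) → Γ ⊢ φ [ t ] → Γ ⊢ ∃' φ
∃-intro φ t d = ⇒-intro (⇒-elim (∀-elim (hyp (here refl)) t) (weaken₁ d))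

∧-intro : ∀ {n} {Γ : List (Formula n)} {φ ψ} → Γ ⊢ φ → Γ ⊢ ψ → Γ ⊢ φ ∧' ψ
∧-intro d e = ⇒-intro (⇒-elim (⇒-elim (hyp (here refl)) (weaken₁ d)) (weaken₁ e))

⊤-intro : ∀ {n} {Γ : List (Formula n)} → Γ ⊢ ⊤'
⊤-intro = ⇒-intro (hyp (here refl))

-- Equality is transitive and a congruence for S; both are instances of
-- ≐-subst with a context in which the fixed side is weakened.
≐-trans : ∀ {n} {Γ : List (Formula n)} {s t u} → Γ ⊢ s ≐ t → Γ ⊢ t ≐ u → Γ ⊢ s ≐ u
≐-trans {s = s} {t} {u} d e =
  cast (cong (_≐ u) (subst₀-weaken u s))
       (≐-subst (renT suc s ≐ var zero) e (cast (cong (_≐ t) (sym (subst₀-weaken t s))) d))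

≐-succ : ∀ {n} {Γ : List (Formula n)} {s t} → Γ ⊢ s ≐ t → Γ ⊢ succ s ≐ succ t
≐-succ {s = s} {t} d =
  cast (cong (λ v → succ v ≐ succ t) (subst₀-weaken t s))
       (≐-subst (succ (renT suc s) ≐ succ (var zero)) d
         (cast (cong (λ v → succ v ≐ succ s) (sym (subst₀-weaken s s))) (≐-refl (succ s))))

numeral-+ : ∀ {n} {Γ : List (Formula n)} a b → Γ ⊢ numeral a ⊕ numeral b ≐ numeral (a ℕ.+ b)
numeral-+ a zero =
  cast (cong (λ k → numeral a ⊕ zer ≐ numeral k) (sym (ℕP.+-identityʳ a)))
       (∀-elim (axiom pa-plus-zero) (numeral a))
numeral-+ a (suc b) =
  cast (cong (λ k → numeral a ⊕ succ (numeral b) ≐ numeral k) (sym (ℕP.+-suc a b)))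
       (≐-trans plus-succ (≐-succ (numeral-+ a b)))
  where
  plus-succ : _ ⊢ numeral a ⊕ succ (numeral b) ≐ succ (numeral a ⊕ numeral b)
  plus-succ = cast (cong (λ v → v ⊕ succ (numeral b) ≐ succ (v ⊕ numeral b))
                         (subst₀-weaken (numeral b) (numeral a)))
                   (∀-elim (∀-elim (axiom pa-plus-succ) (numeral a)) (numeral b))

numeral-≤ : ∀ {n} {Γ : List (Formula n)} {a b} → a ℕ.≤ b → Γ ⊢ numeral a ≤' numeral b
numeral-≤ {a = a} {b} a≤b = ∃-intro _ (numeral (b ℕ.∸ a))
  (cast (cong₂ (λ u v → u ⊕ numeral (b ℕ.∸ a) ≐ v)
               (sym (subst₀-weaken _ (numeral a))) (sym (subst₀-weaken _ (numeral b))))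
        (cast (cong (λ k → numeral a ⊕ numeral (b ℕ.∸ a) ≐ numeral k) (ℕP.m+[n∸m]≡n a≤b))
              (numeral-+ a (b ℕ.∸ a))))

-- a <' b is defined as S a ≤' b, and S applied to numeral a is numeral (a + 1).
numeral-< : ∀ {n} {Γ : List (Formula n)} {a b} → a ℕ.< b → Γ ⊢ numeral a <' numeral b
numeral-< = numeral-≤

-- Codes of strings.  bitsValue acc r appends the bits of r to the binary
-- expansion of acc, so it lies in [acc·2^N, (acc+1)·2^N).

bitsValue-lower : ∀ {N} acc (r : Vec Bool N) → acc ℕ.* 2 ^ N ℕ.≤ bitsValue acc r
bitsValue-lower acc [] = ℕP.≤-reflexive (ℕP.*-identityʳ acc)
bitsValue-lower {suc N} acc (false ∷ r) =
  ℕP.≤-trans (ℕP.≤-reflexive (sym (ℕP.*-assoc acc 2 (2 ^ N)))) (bitsValue-lower (acc ℕ.* 2) r)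
bitsValue-lower {suc N} acc (true ∷ r) =
  ℕP.≤-trans (ℕP.≤-reflexive (sym (ℕP.*-assoc acc 2 (2 ^ N))))
    (ℕP.≤-trans (ℕP.*-monoˡ-≤ (2 ^ N) (ℕP.n≤1+n (acc ℕ.* 2))) (bitsValue-lower (suc (acc ℕ.* 2)) r))

bitsValue-upper : ∀ {N} acc (r : Vec Bool N) → bitsValue acc r ℕ.< suc acc ℕ.* 2 ^ N
bitsValue-upper acc [] = ℕP.≤-reflexive (cong suc (sym (ℕP.*-identityʳ acc)))
bitsValue-upper {suc N} acc (false ∷ r) =
  ℕP.<-≤-trans (bitsValue-upper (acc ℕ.* 2) r)
    (ℕP.≤-trans (ℕP.*-monoˡ-≤ (2 ^ N) (ℕP.n≤1+n (suc (acc ℕ.* 2))))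
                (ℕP.≤-reflexive (ℕP.*-assoc (suc acc) 2 (2 ^ N))))
bitsValue-upper {suc N} acc (true ∷ r) =
  ℕP.<-≤-trans (bitsValue-upper (suc (acc ℕ.* 2)) r) (ℕP.≤-reflexive (ℕP.*-assoc (suc acc) 2 (2 ^ N)))

code-IsStr : ∀ {n} {Γ : List (Formula n)} {N} (r : Vec Bool N) → Γ ⊢ IsStr N (numeral (code r))
code-IsStr {N = N} r = ∧-intro
  (numeral-≤ (ℕP.≤-trans (ℕP.≤-reflexive (sym (ℕP.*-identityˡ (2 ^ N)))) (bitsValue-lower 1 r)))
  (numeral-< (bitsValue-upper 1 r))

strings : (N : ℕ) → List (Vec Bool N)
strings zero    = [] ∷ []
strings (suc N) = map (false ∷_) (strings N) ++ map (true ∷_) (strings N)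

Increasing : ∀ {N} → (Vec Bool N → ℕ) → List (Vec Bool N) → Set
Increasing value = AllPairs (λ r s → value r ℕ.< value s)

-- Lexicographic order agrees with the order of the values: every string
-- starting with 0 has a smaller value than every string starting with 1.
strings-increasing : ∀ N acc → Increasing (bitsValue acc) (strings N)
strings-increasing zero acc = [] ∷ []
strings-increasing (suc N) acc =
  AllPairsP.++⁺ (AllPairsP.map⁺ (strings-increasing N (acc ℕ.* 2)))
                (AllPairsP.map⁺ (strings-increasing N (suc (acc ℕ.* 2))))
                (AllP.map⁺ (All.universal (λ r → AllP.map⁺ (All.universal (λ s →
                   ℕP.<-≤-trans (bitsValue-upper (acc ℕ.* 2) r)
                                (bitsValue-lower (suc (acc ℕ.* 2)) s)) _)) _))

module Counting {Δ : List Sentence} (N : ℕ) (R : Formula 1) where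

  Refuted : Vec Bool N → Set
  Refuted r = Δ ⊢ ¬' (R [ numeral (code r) ])

  refuted-Bad : ∀ r → Refuted r → Δ ⊢ Bad N R [ numeral (code r) ]
  refuted-Bad r d = cast (sym (Bad-instance N R (numeral (code r)))) (∧-intro (code-IsStr r) d)

  -- The witnesses of MoreAbove k above x are the first k strings of the list.
  more-above : ∀ k x (L : List (Vec Bool N)) → All (λ r → x ℕ.< code r) L →
    Increasing code L → All Refuted L → k ℕ.≤ length L → Δ ⊢ MoreAbove N R k [ numeral x ]
  more-above zero x L _ _ _ _ = ⊤-intro
  more-above (suc k) x (r ∷ L) (x<r ∷ _) (r<L ∷ inc) (dr ∷ dL) (s≤s k≤L) =
    ∃-intro _ y (cast (sym instance-eq)
      (∧-intro (numeral-< x<r)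
        (∧-intro (refuted-Bad r dr) (more-above k (code r) L r<L inc dL k≤L))))
    where
    y : Term 0
    y = numeral (code r)
    instance-eq : sub (subst₀ y) (sub (liftS (subst₀ (numeral x)))
                    ((var (suc zero) <' var zero) ∧' (ren keep0 (Bad N R) ∧' ren keep0 (MoreAbove N R k))))
                  ≡ ((numeral x <' y) ∧' ((Bad N R [ y ]) ∧' (MoreAbove N R k [ y ])))
    instance-eq = cong₂ _∧'_ (ordering-instance (numeral x) y)
                    (cong₂ _∧'_ (keep0-instance (numeral x) y (Bad N R))
                                (keep0-instance (numeral x) y (MoreAbove N R k)))

  at-least : ∀ k (L : List (Vec Bool N)) → Increasing code L → All Refuted L →
    suc k ℕ.≤ length L → Δ ⊢ AtLeastSuc N R k
  at-least k (r ∷ L) (r<L ∷ inc) (dr ∷ dL) (s≤s k≤L) =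
    ∃-intro _ (numeral (code r)) (∧-intro (refuted-Bad r dr) (more-above k (code r) L r<L inc dL k≤L))

-- Uniform averages over strings.

count : ∀ N {P : Pred (Vec Bool N) 0ℓ} → Decidable P → ℕ
count N P? = length (filter P? (strings N))

length-filter-map : ∀ {A B : Set} {P : Pred B 0ℓ} (P? : Decidable P) (h : A → B) xs →
  length (filter P? (map h xs)) ≡ length (filter (λ x → P? (h x)) xs)
length-filter-map P? h [] = refl
length-filter-map P? h (x ∷ xs) with does (P? (h x))
... | true  = cong suc (length-filter-map P? h xs)
... | false = length-filter-map P? h xs

count-suc : ∀ N {P : Pred (Vec Bool (suc N)) 0ℓ} (P? : Decidable P) →
  count (suc N) P? ≡ count N (λ r → P? (false ∷ r)) ℕ.+ count N (λ r → P? (true ∷ r))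
count-suc N P? = begin
  length (filter P? (F ++ T))                       ≡⟨ cong length (ListP.filter-++ P? F T) ⟩
  length (filter P? F ++ filter P? T)               ≡⟨ ListP.length-++ (filter P? F) ⟩
  length (filter P? F) ℕ.+ length (filter P? T)     ≡⟨ cong₂ ℕ._+_ (length-filter-map P? _ (strings N))
                                                                    (length-filter-map P? _ (strings N)) ⟩
  _ ∎
  where
  open ≡-Reasoning
  F T : List (Vec Bool (suc N))
  F = map (false ∷_) (strings N)
  T = map (true ∷_) (strings N)

avg-mono : ∀ N (f g : Vec Bool N → ℚ) → (∀ r → f r ≤ g r) → avg N f ≤ avg N g
avg-mono zero f g f≤g = f≤g []
avg-mono (suc N) f g f≤g = ℚP.*-monoˡ-≤-nonNeg ½
  (ℚP.+-mono-≤ (avg-mono N _ _ (λ r → f≤g (true ∷ r))) (avg-mono N _ _ (λ r → f≤g (false ∷ r))))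

avg-const : ∀ N q → avg N (λ _ → q) ≡ q
avg-const zero q = refl
avg-const (suc N) q = trans (cong (λ x → ½ * (x + x)) (avg-const N q))
  (solve 1 (λ x → con ½ :* (x :+ x) := x) refl q)

avg-shift : ∀ N d (f : Vec Bool N → ℚ) → avg N (λ r → d + f r) ≡ d + avg N f
avg-shift zero d f = refl
avg-shift (suc N) d f =
  trans (cong₂ (λ x y → ½ * (x + y)) (avg-shift N d _) (avg-shift N d _))
        (solve 3 (λ d a b → con ½ :* ((d :+ a) :+ (d :+ b)) := d :+ con ½ :* (a :+ b)) refl
               d (avg N (λ r → f (true ∷ r))) (avg N (λ r → f (false ∷ r))))

embed : ℕ → ℚ
embed n = fromℤ (+ n)

-- The embedding is additive (checked on unnormalised fractions).

embed-+ : ∀ m n → embed (m ℕ.+ n) ≡ embed m + embed n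
embed-+ m n = ℚP.toℚᵘ-injective (ℚᵘP.≃-trans sum (ℚᵘP.≃-sym (ℚP.toℚᵘ-homo-+ (embed m) (embed n))))
  where
  sum : ℚ.toℚᵘ (embed (m ℕ.+ n)) ℚᵘ.≃ (ℚ.toℚᵘ (embed m) ℚᵘ.+ ℚ.toℚᵘ (embed n))
  sum = ℚᵘ.*≡* (trans (ℤP.*-identityʳ (+ (m ℕ.+ n)))
          (sym (trans (ℤP.*-identityʳ _)
                 (trans (cong₂ ℤ._+_ (ℤP.*-identityʳ (+ m)) (ℤP.*-identityʳ (+ n)))
                        (sym (ℤP.pos-+ m n))))))

indicator : ∀ {N} {P : Pred (Vec Bool N) 0ℓ} → Decidable P → Vec Bool N → ℚ
indicator P? r = if does (P? r) then 1ℚ else 0ℚ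

avg-indicator : ∀ N {P : Pred (Vec Bool N) 0ℓ} (P? : Decidable P) →
  avg N (indicator P?) * embed (2 ^ N) ≡ embed (count N P?)
avg-indicator zero P? with does (P? [])
... | true  = refl
... | false = refl
avg-indicator (suc N) P? = begin
  ½ * (A + B) * embed (M ℕ.+ (M ℕ.+ 0))
    ≡⟨ cong (λ z → ½ * (A + B) * z) (trans (embed-+ M (M ℕ.+ 0)) (cong (λ z → embed M + z) (embed-+ M 0))) ⟩
  ½ * (A + B) * (embed M + (embed M + 0ℚ))
    ≡⟨ solve 3 (λ a b m → con ½ :* (a :+ b) :* (m :+ (m :+ con 0ℚ)) := b :* m :+ a :* m) refl A B (embed M) ⟩
  B * embed M + A * embed M
    ≡⟨ cong₂ _+_ (avg-indicator N (λ r → P? (false ∷ r))) (avg-indicator N (λ r → P? (true ∷ r))) ⟩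
  embed count₀ + embed count₁
    ≡⟨ sym (embed-+ count₀ count₁) ⟩
  embed (count₀ ℕ.+ count₁)
    ≡⟨ cong embed (sym (count-suc N P?)) ⟩
  embed (count (suc N) P?) ∎
  where
  open ≡-Reasoning
  M count₀ count₁ : ℕ
  M = 2 ^ N
  count₀ = count N (λ r → P? (false ∷ r))
  count₁ = count N (λ r → P? (true ∷ r))
  A B : ℚ
  A = avg N (λ r → indicator P? (true ∷ r))
  B = avg N (λ r → indicator P? (false ∷ r))

markov : ∀ N (f : Vec Bool N → ℚ) d δ → 0ℚ ≤ d → (∀ r → f r ≤ 1ℚ) → d + δ < avg N f →
  δ < avg N (indicator (λ r → d ℚ.<? f r))
markov N f d δ 0≤d f≤1 d+δ<avg = cancelˡ (ℚP.<-≤-trans d+δ<avg avg≤)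
  where
  cancelˡ : ∀ {x y} → d + x < d + y → x < y
  cancelˡ {x} {y} lt = subst₂ _<_ (cancel x) (cancel y) (ℚP.+-monoʳ-< (- d) lt)
    where
    cancel : ∀ z → (- d) + (d + z) ≡ z
    cancel z = solve 2 (λ d z → (:- d) :+ (d :+ z) := z) refl d z
  below-threshold : ∀ x (d<x? : Dec (d < x)) → x ≤ 1ℚ → x ≤ d + (if does d<x? then 1ℚ else 0ℚ)
  below-threshold x (yes _)  x≤1 = ℚP.≤-trans x≤1 (ℚP.≤-trans (ℚP.≤-reflexive (sym (ℚP.+-identityˡ 1ℚ)))
                                                            (ℚP.+-monoˡ-≤ 1ℚ 0≤d))
  below-threshold x (no x≤d) _   = ℚP.≤-trans (ℚP.≮⇒≥ x≤d) (ℚP.≤-reflexive (sym (ℚP.+-identityʳ d)))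
  pointwise : ∀ r → f r ≤ d + indicator (λ r → d ℚ.<? f r) r
  pointwise r = below-threshold (f r) (d ℚ.<? f r) (f≤1 r)
  avg≤ : avg N f ≤ d + avg N (indicator (λ r → d ℚ.<? f r))
  avg≤ = ℚP.≤-trans (avg-mono N f _ pointwise) (ℚP.≤-reflexive (avg-shift N d _))

scaled-< : ∀ (δ : ℚ) K m → 0ℚ < δ → δ * embed (suc K) < embed m →
  ℤ.∣ ↥ δ ∣ ℕ.* suc K ℕ.< m ℕ.* suc (ℚ.denominator-1 δ)
scaled-< δ@(mkℚ -[1+ _ ] _ _) K m 0<δ _ = ⊥-elim (ℚP.<-asym 0<δ (ℚP.negative⁻¹ δ))
scaled-< δ@(mkℚ (+ a) d _) K m 0<δ δK<m = ℤP.drop‿+<+ (subst₂ ℤ._<_ lhs rhs cross)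
  where
  cross : (+ a ℤ.* + suc K) ℤ.* + 1 ℤ.< + m ℤ.* + suc (d ℕ.* 1)
  cross = ℚᵘP.drop-*<* (ℚᵘP.<-respˡ-≃ (ℚP.toℚᵘ-homo-* δ (embed (suc K))) (ℚP.toℚᵘ-mono-< δK<m))
  lhs : (+ a ℤ.* + suc K) ℤ.* + 1 ≡ + (a ℕ.* suc K)
  lhs = trans (ℤP.*-identityʳ _) (sym (ℤP.pos-* a (suc K)))
  rhs : + m ℤ.* + suc (d ℕ.* 1) ≡ + (m ℕ.* suc d)
  rhs = trans (cong (λ k → + m ℤ.* + suc k) (ℕP.*-identityʳ d)) (sym (ℤP.pos-* m (suc d)))

proportion-count : ∀ N {P : Pred (Vec Bool N) 0ℓ} (P? : Decidable P) δ → 0ℚ < δ →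
  δ < avg N (indicator P?) → floorScaled δ N ℕ.< count N P?
proportion-count N P? δ 0<δ δ<avg = ℕDivMod.m<n*o⇒m/o<n (scaled (ℕP.m^n>0 2 N) (avg-indicator N P?))
  where
  -- 2^N is positive, so it has the form K + 1.
  scaled : ∀ {K} → 0 ℕ.< K → avg N (indicator P?) * embed K ≡ embed (count N P?) →
    ℤ.∣ ↥ δ ∣ ℕ.* K ℕ.< count N P? ℕ.* suc (ℚ.denominator-1 δ)
  scaled {suc K} _ eq = scaled-< δ K (count N P?) 0<δ
    (subst (δ * embed (suc K) <_) eq (ℚP.*-monoˡ-<-pos (embed (suc K)) δ<avg))

-- Strategies.

prob≤1 : ∀ {Γ c} F (π : Strategy Γ c) → ProbAchieve F π ≤ 1ℚ
prob≤1 {Γ} F stop with DecMembership._∈?_ _≟F_ F Γ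
... | yes _ = ℚP.≤-refl
... | no _  = ℚP.<⇒≤ (ℚP.positive⁻¹ 1ℚ)
prob≤1 F (ordinary φ d π) = prob≤1 F π
prob≤1 F (randomized N δ R _ _ _ next) =
  ℚP.≤-trans (avg-mono N _ (λ _ → 1ℚ) (λ r → prob≤1 F (next r))) (ℚP.≤-reflexive (avg-const N 1ℚ))

achieve⇒prove : ∀ {Γ c} F (π : Strategy Γ c) → 0ℚ ≤ c → c < ProbAchieve F π → Γ ⊢ F
-- At a leaf the probability is 0 or 1; it exceeds c ≥ 0, so F is accepted.
achieve⇒prove {Γ} F stop 0≤c c<p with DecMembership._∈?_ _≟F_ F Γ
... | yes F∈Γ = hyp F∈Γ
... | no _    = ⊥-elim (ℚP.<-irrefl refl (ℚP.≤-<-trans 0≤c c<p))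
-- An ordinary step is eliminated by a cut with its derivation.
achieve⇒prove F (ordinary φ dφ π) 0≤c c<p = ⇒-elim (⇒-intro (achieve⇒prove F π 0≤c c<p)) dφ
-- At a randomized step, ¬F refutes R at every good outcome, and there are
-- more than ⌊δ·2^N⌋ good outcomes; this contradicts the count bound.
achieve⇒prove {Γ} {c} F (randomized N δ R 0<δ δ≤c bound∈Γ next) 0≤c c<p =
  raa (⇒-elim (weaken₁ (hyp bound∈Γ))
              (at-least (floorScaled δ N) good (AllPairsP.filter⁺ good? (strings-increasing N 1))
                        (All.map refute (AllP.all-filter good? (strings N))) many-good))
  where
  open Counting {¬' F ∷ Γ} N R
  d : ℚ
  d = c - δ
  0≤d : 0ℚ ≤ d
  0≤d = subst (_≤ d) (ℚP.+-inverseʳ δ) (ℚP.+-monoˡ-≤ (- δ) δ≤c)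
  p : Vec Bool N → ℚ
  p r = ProbAchieve F (next r)
  good? : Decidable (λ r → d < p r)
  good? r = d ℚ.<? p r
  good : List (Vec Bool N)
  good = filter good? (strings N)
  -- A good outcome's child proves F from R(r), so ¬F refutes R(r).
  refute : ∀ {r} → d < p r → Refuted r
  refute {r} d<p = ⇒-intro (⇒-elim (hyp (there (here refl)))
    (weaken (λ { (here q) → here q ; (there q) → there (there q) })
            (achieve⇒prove F (next r) 0≤d d<p)))
  many-good : suc (floorScaled δ N) ℕ.≤ length good
  many-good = proportion-count N good? δ 0<δ
    (markov N p d δ 0≤d (λ r → prob≤1 F (next r))
      (subst (_< avg N p) (solve 2 (λ c δ → c := (c :- δ) :+ δ) refl c δ) c<p))

proposition2 : (ε : ℚ) → 0ℚ < ε → (F : Sentence) → (π : Strategy [] ε) →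
               ε < ProbAchieve F π → PA⊢ F
proposition2 ε 0<ε F π ε<p = achieve⇒prove F π (ℚP.<⇒≤ 0<ε) ε<p
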